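{- Let $q>2$ and $n\ge1$ be integers, $h\in\{0,\ldots,n\}$, and $\lambda=(q-1)n-qh$. Let $\varphi:B_h\to\mathbb{C}$ be an arbitrary function and suppose $f$ is a $\lambda$-function with $f(\alpha)=\varphi(\alpha)$ for all $\alpha\in B_h$. Then all values of $f$ are uniquely determined by $\varphi$; that is, if $f,g$ are $\lambda$-functions with $f=g$ on $B_h$, then $f=g$ on all of $\mathbf{F}_q^n$.
   Context: $\mathbf{F}_q=\{0,\ldots,q-1\}$ is the additive group of integers mod $q$; $\mathbf{F}_q^n$ is the vertex set of the $q$-ary $n$-dimensional Hamming graph (adjacency: differing in exactly one coordinate). $\rho$ is Hamming distance and $B_h=\{\alpha:\rho(\alpha,\mathbf{0})\le h\}$; $W_1(\alpha)=\{\beta:\rho(\alpha,\beta)=1\}$. A $\lambda$-function is $f:\mathbf{F}_q^n\to\mathbb{C}$ with $\sum_{\beta\in W_1(\alpha)}f(\beta)=\lambda f(\alpha)$ for all $\alpha$. -}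

module Defs where

open import Level using (Level)
open import Algebra.Bundles using (CommutativeRing)
open import Data.Nat using (ℕ; zero; suc; _<_; _≤_; z<s)
open import Data.Nat.Properties using (<-trans)
open import Data.Fin using (Fin; fromℕ<)
open import Data.Fin.Properties using () renaming (_≟_ to _≟ᶠ_)
open import Data.Vec using (Vec; []; _∷_; replicate)
open import Data.List using (List; []; _∷_; [_]; map; concatMap; filter; foldr)
open import Data.List.Base using (allFin)
open import Data.Product using (_×_)
open import Data.Sum using (_⊎_)
open import Relation.Nullary using (yes; no; ¬_)
open import Relation.Binary.PropositionalEquality using (_≡_)
import Data.Nat as ℕ

-- Vertex set F_q^n of the Hamming graph: vectors of length n over Fin q
-- (Fin q = {0,…,q-1}, the integers mod q).
Vertex : ℕ → ℕ → Set
Vertex q n = Vec (Fin q) n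

allVertices : (q n : ℕ) → List (Vertex q n)
allVertices q zero    = [ [] ]
allVertices q (suc n) = concatMap (λ a → map (a ∷_) (allVertices q n)) (allFin q)

ρ : ∀ {q n} → Vertex q n → Vertex q n → ℕ
ρ []       []       = 0
ρ (a ∷ α) (b ∷ β) with a ≟ᶠ b
... | yes _ = ρ α β
... | no  _ = suc (ρ α β)

-- the zero vertex 𝟎 (needs q > 0; we use the standing hypothesis q > 2)
𝟎 : ∀ {q} n → 2 < q → Vertex q n
𝟎 n q>2 = replicate n (fromℕ< (<-trans z<s (<-trans (ℕ.s<s z<s) q>2)))

_∈B[_,_] : ∀ {q n} → Vertex q n → ℕ → 2 < q → Set
_∈B[_,_] {n = n} α h q>2 = ρ α (𝟎 n q>2) ≤ h

W₁ : ∀ {q n} → Vertex q n → List (Vertex q n)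
W₁ {q} {n} α = filter (λ β → ρ α β ℕ.≟ 1) (allVertices q n)

module _ {c ℓ : Level} (R : CommutativeRing c ℓ) where
  open CommutativeRing R

  ∑ : List Carrier → Carrier
  ∑ = foldr _+_ 0#

  ι : ℕ → Carrier
  ι zero    = 0#
  ι (suc k) = 1# + ι k

  IsIntegralDomainChar0 : Set (c Level.⊔ ℓ)
  IsIntegralDomainChar0 =
    (¬ (1# ≈ 0#)) ×
    ((∀ x y → x * y ≈ 0# → x ≈ 0# ⊎ y ≈ 0#) ×
     (∀ k → ι k ≈ 0# → k ≡ 0))

  IsλFunction : ∀ {q n} → Carrier → (Vertex q n → Carrier) → Set ℓ
  IsλFunction λ′ f = ∀ α → ∑ (map f (W₁ α)) ≈ λ′ * f α

-- Let q = q' + 1.  Say d : F_q^n → R has data (A, B) (natural numbers) if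
-- Σ_{β ∈ W₁(α)} d(β) + A·d(α) = B·d(α) for all α; the difference of two
-- λ-functions with λ = (q-1)n - qh has data (qh, (q-1)n).  By induction on n:
--   if d has data (q·a, (q-1)·n + q·b) and vanishes wherever ρ(α, z) + b ≤ a
--   (a ball of radius a - b, empty if b > a), then d = 0.
-- For n = 0 this is the vanishing hypothesis (b ≤ a), or characteristic zero
-- and the absence of zero divisors (a < b).  For n + 1 split vertices as c ∷ y:
-- the neighbours of c ∷ y are the c ∷ β with β ~ y and the c' ∷ y with c' ≠ c,
-- so each slice d(c ∷ ·) is an eigenfunction up to the column sum Σ_c' d(c' ∷ y).
-- Differences of slices cancel that sum, have data with b + 1 and vanish on
-- the smaller ball, hence all slices coincide; then the column sum is q times
-- the central slice, which has data with the same a, b and is zero by induction.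

module Submission where

open import Defs
open import Level using (Level)
open import Algebra.Bundles using (CommutativeRing)
open import Data.Nat using (ℕ; _<_; _≤_; _∸_)
import Data.Nat as ℕ
open import Data.Nat using (zero; suc)
import Data.Nat.Properties as ℕP
open import Data.Nat.Tactic.RingSolver using (solve-∀)
open import Data.Fin using (Fin; punchIn) renaming (zero to fzero; suc to fsuc)
open import Data.Fin.Properties using (punchInᵢ≢i) renaming (_≟_ to _≟ᶠ_)
open import Data.Vec using ([]; _∷_; head; tail)
open import Data.Vec.Functional using (removeAt)
open import Data.List using (List; []; _∷_; map; filter; concatMap; _++_; tabulate; allFin)
open import Data.List.Properties using (map-concatMap; map-∘; map-cong)
open import Function using (_∘_)
open import Data.Sum using (inj₁; inj₂)
open import Data.Product using (proj₁; proj₂)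
open import Data.Bool using (true; false; if_then_else_)
open import Relation.Nullary using (Dec; yes; no; does)
open import Relation.Binary.PropositionalEquality as P using (_≡_; _≢_)
open import Data.Empty using (⊥-elim)

module Distance {q : ℕ} where

  ρ-cons-≡ : ∀ {n} (c : Fin q) (α β : Vertex q n) → ρ (c ∷ α) (c ∷ β) ≡ ρ α β
  ρ-cons-≡ c α β with c ≟ᶠ c
  ... | yes _  = P.refl
  ... | no c≢c = ⊥-elim (c≢c P.refl)

  ρ-cons-≢ : ∀ {n} {c c' : Fin q} (α β : Vertex q n) → c ≢ c' →
             ρ (c ∷ α) (c' ∷ β) ≡ suc (ρ α β)
  ρ-cons-≢ {c = c} {c'} α β c≢c' with c ≟ᶠ c'
  ... | yes c≡c' = ⊥-elim (c≢c' c≡c')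
  ... | no _     = P.refl

  ρ-cons-≤ : ∀ {n} (c c' : Fin q) (α β : Vertex q n) → ρ (c ∷ α) (c' ∷ β) ≤ suc (ρ α β)
  ρ-cons-≤ c c' α β with c ≟ᶠ c'
  ... | yes _ = ℕP.n≤1+n _
  ... | no _  = ℕP.≤-refl

  ρ-self : ∀ {n} (α : Vertex q n) → ρ α α ≡ 0
  ρ-self []      = P.refl
  ρ-self (c ∷ α) = P.trans (ρ-cons-≡ c α α) (ρ-self α)

  ρ≡0⇒≡ : ∀ {n} (α β : Vertex q n) → ρ α β ≡ 0 → α ≡ β
  ρ≡0⇒≡ []      []      _ = P.refl
  ρ≡0⇒≡ (c ∷ α) (c' ∷ β) ρ≡0 with c ≟ᶠ c'
  ... | yes P.refl = P.cong (c ∷_) (ρ≡0⇒≡ α β ρ≡0)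
  ... | no _ with ρ≡0
  ...   | ()

module Arithmetic {c ℓ} (R : CommutativeRing c ℓ) where
  open CommutativeRing R hiding (zero)
  open import Algebra.Properties.Ring ring public
    using (+-cancelˡ; +-cancelʳ; -‿+-comm; -‿distribʳ-*; x∙y⁻¹≈ε⇒x≈y; x≈y⇒x∙y⁻¹≈ε; //-rightDividesˡ)
  open import Algebra.Properties.CommutativeSemigroup +-commutativeSemigroup
    using (interchange)
  open import Algebra.Properties.CommutativeSemigroup +-commutativeSemigroup public
    using (xy∙z≈xz∙y)
  open import Algebra.Properties.CommutativeMonoid.Sum +-commutativeMonoid public
    using (sum; sum-remove; sum-cong-≋; sum-cong-≗; sum-replicate; sum-replicate-zero)
  open import Algebra.Definitions.RawMonoid +-rawMonoid using (_×_)
  open import Algebra.Properties.Monoid.Mult +-monoid using (×-homo-+; ×-congʳ)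
  open import Algebra.Properties.Semiring.Mult semiring using (×-assoc-*)
  open import Relation.Binary.Reasoning.Setoid setoid

  sub-+-interchange : ∀ a b c d → (a - b) + (c - d) ≈ (a + c) - (b + d)
  sub-+-interchange a b c d = begin
    (a - b) + (c - d)     ≈⟨ interchange a (- b) c (- d) ⟩
    (a + c) + (- b + - d) ≈⟨ +-congˡ (-‿+-comm b d) ⟩
    (a + c) - (b + d)     ∎

  *-distribˡ-sub : ∀ m a b → m * (a - b) ≈ m * a - m * b
  *-distribˡ-sub m a b = begin
    m * (a - b)       ≈⟨ distribˡ m a (- b) ⟩
    m * a + m * (- b) ≈⟨ +-congˡ (sym (-‿distribʳ-* m b)) ⟩
    m * a - m * b     ∎

  sub-common : ∀ {P₁ P₂ Y₁ Y₂} T → P₁ + T ≈ Y₁ → P₂ + T ≈ Y₂ → P₁ - P₂ ≈ Y₁ - Y₂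
  sub-common {P₁} {P₂} {Y₁} {Y₂} T e₁ e₂ = begin
    P₁ - P₂                 ≈⟨ sym (+-identityʳ _) ⟩
    (P₁ - P₂) + 0#          ≈⟨ +-congˡ (sym (-‿inverseʳ T)) ⟩
    (P₁ - P₂) + (T - T)     ≈⟨ sub-+-interchange P₁ P₂ T T ⟩
    (P₁ + T) - (P₂ + T)     ≈⟨ +-cong e₁ (-‿cong e₂) ⟩
    Y₁ - Y₂                 ∎

  ι≡× : ∀ k → ι R k ≡ k × 1#
  ι≡× zero    = P.refl
  ι≡× (suc k) = P.cong (1# +_) (ι≡× k)

  ι-+ : ∀ m n → ι R (m ℕ.+ n) ≈ ι R m + ι R n
  ι-+ m n = begin
    ι R (m ℕ.+ n)        ≡⟨ ι≡× (m ℕ.+ n) ⟩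
    (m ℕ.+ n) × 1#       ≈⟨ ×-homo-+ 1# m n ⟩
    m × 1# + n × 1#      ≡⟨ P.cong₂ _+_ (P.sym (ι≡× m)) (P.sym (ι≡× n)) ⟩
    ι R m + ι R n        ∎

  ι-suc-* : ∀ k x → ι R (suc k) * x ≈ x + ι R k * x
  ι-suc-* k x = trans (distribʳ x 1# (ι R k)) (+-congʳ (*-identityˡ x))

  sum-const : ∀ m x → sum {m} (λ _ → x) ≈ ι R m * x
  sum-const m x = begin
    sum {m} (λ _ → x)    ≈⟨ sum-replicate m ⟩
    m × x                ≈⟨ ×-congʳ m (sym (*-identityˡ x)) ⟩
    m × (1# * x)         ≈⟨ sym (×-assoc-* m 1# x) ⟩
    (m × 1#) * x         ≡⟨ P.cong (_* x) (P.sym (ι≡× m)) ⟩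
    ι R m * x            ∎

  sum-point : ∀ {m} (t : Fin m → Carrier) j → (∀ i → i ≢ j → t i ≈ 0#) → sum t ≈ t j
  sum-point {suc m} t j off = begin
    sum t                    ≈⟨ sum-remove {i = j} t ⟩
    t j + sum (removeAt t j) ≈⟨ +-congˡ (sum-cong-≋ (λ i → off (punchIn j i) (punchInᵢ≢i j i))) ⟩
    t j + sum {m} (λ _ → 0#) ≈⟨ +-congˡ (sum-replicate-zero m) ⟩
    t j + 0#                 ≈⟨ +-identityʳ (t j) ⟩
    t j                      ∎

  sum-replace : ∀ {m} (t u : Fin m → Carrier) j {x} → t j ≈ x → (∀ i → i ≢ j → t i ≈ u i) →
                sum t + u j ≈ x + sum u
  sum-replace {suc m} t u j {x} tj≈x off = begin
    sum t + u j                        ≈⟨ +-congʳ (sum-remove {i = j} t) ⟩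
    (t j + sum (removeAt t j)) + u j   ≈⟨ +-congʳ (+-cong tj≈x (sum-cong-≋ (λ i → off (punchIn j i) (punchInᵢ≢i j i)))) ⟩
    (x + sum (removeAt u j)) + u j     ≈⟨ +-assoc x _ (u j) ⟩
    x + (sum (removeAt u j) + u j)     ≈⟨ +-congˡ (+-comm _ (u j)) ⟩
    x + (u j + sum (removeAt u j))     ≈⟨ +-congˡ (sym (sum-remove {i = j} u)) ⟩
    x + sum u                          ∎

  ∑-++ : ∀ xs ys → ∑ R (xs ++ ys) ≈ ∑ R xs + ∑ R ys
  ∑-++ []       ys = sym (+-identityˡ _)
  ∑-++ (x ∷ xs) ys = trans (+-congˡ (∑-++ xs ys)) (sym (+-assoc x _ _))

  ∑-concatMap : ∀ {A : Set} (F : A → List Carrier) xs →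
                ∑ R (concatMap F xs) ≈ ∑ R (map (λ a → ∑ R (F a)) xs)
  ∑-concatMap F []       = refl
  ∑-concatMap F (x ∷ xs) = trans (∑-++ (F x) (concatMap F xs)) (+-congˡ (∑-concatMap F xs))

  ∑-filter : ∀ {A : Set} {Pr : A → Set} (Pr? : ∀ x → Dec (Pr x)) (k : A → Carrier) xs →
             ∑ R (map k (filter Pr? xs)) ≈ ∑ R (map (λ x → if does (Pr? x) then k x else 0#) xs)
  ∑-filter Pr? k [] = refl
  ∑-filter Pr? k (x ∷ xs) with does (Pr? x)
  ... | true  = +-congˡ (∑-filter Pr? k xs)
  ... | false = trans (∑-filter Pr? k xs) (sym (+-identityˡ _))

  ∑-sub : ∀ {A : Set} (f g : A → Carrier) xs →
          ∑ R (map (λ x → f x - g x) xs) ≈ ∑ R (map f xs) - ∑ R (map g xs)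
  ∑-sub f g []       = sym (-‿inverseʳ 0#)
  ∑-sub f g (x ∷ xs) = trans (+-congˡ (∑-sub f g xs)) (sub-+-interchange _ _ _ _)

  ∑-tabulate : ∀ {A : Set} m (f : Fin m → A) (k : A → Carrier) →
               ∑ R (map k (tabulate f)) ≡ sum (λ i → k (f i))
  ∑-tabulate zero    f k = P.refl
  ∑-tabulate (suc m) f k = P.cong (k (f fzero) +_) (∑-tabulate m (λ i → f (fsuc i)) k)

module Neighbourhood {c ℓ} (R : CommutativeRing c ℓ) (q' : ℕ) where
  open CommutativeRing R hiding (zero)
  open Arithmetic R
  open Distance
  open import Relation.Binary.Reasoning.Setoid setoid

  q : ℕ
  q = suc q'

  V : ℕ → Set
  V n = Vertex q n

  ΣV : ∀ n → (V n → Carrier) → Carrier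
  ΣV n k = ∑ R (map k (allVertices q n))

  nbrSum : ∀ {n} → (V n → Carrier) → V n → Carrier
  nbrSum d α = ∑ R (map d (W₁ α))

  onSphere : ∀ {n} → V n → (V n → Carrier) → V n → Carrier
  onSphere α d β = if does (ρ α β ℕ.≟ 1) then d β else 0#

  nbrSum-onSphere : ∀ {n} (d : V n → Carrier) α → nbrSum d α ≈ ΣV n (onSphere α d)
  nbrSum-onSphere {n} d α = ∑-filter (λ β → ρ α β ℕ.≟ 1) d (allVertices q n)

  nbrSum-sub : ∀ {n} (f g : V n → Carrier) α →
               nbrSum (λ β → f β - g β) α ≈ nbrSum f α - nbrSum g α
  nbrSum-sub f g α = ∑-sub f g (W₁ α)

  ΣV-cons : ∀ n (k : V (suc n) → Carrier) → ΣV (suc n) k ≈ sum (λ c → ΣV n (λ β → k (c ∷ β)))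
  ΣV-cons n k = begin
    ∑ R (map k (concatMap slice (allFin q)))          ≡⟨ P.cong (∑ R) (map-concatMap k slice (allFin q)) ⟩
    ∑ R (concatMap (λ c → map k (slice c)) (allFin q))  ≈⟨ ∑-concatMap (λ c → map k (slice c)) (allFin q) ⟩
    ∑ R (map (λ c → ∑ R (map k (slice c))) (allFin q))  ≡⟨ ∑-tabulate q (λ c → c) (λ c → ∑ R (map k (slice c))) ⟩
    sum (λ c → ∑ R (map k (slice c)))                   ≡⟨ sum-cong-≗ (λ c → P.cong (∑ R) (P.sym (map-∘ {g = k} {f = c ∷_} (allVertices q n)))) ⟩
    sum (λ c → ΣV n (λ β → k (c ∷ β)))                  ∎
    where
    slice : Fin q → List (V (suc n))
    slice c = map (c ∷_) (allVertices q n)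

  ΣV-point : ∀ n (k : V n → Carrier) α → (∀ β → β ≢ α → k β ≈ 0#) → ΣV n k ≈ k α
  ΣV-point zero    k []      off = +-identityʳ (k [])
  ΣV-point (suc n) k (c ∷ α) off = begin
    ΣV (suc n) k                          ≈⟨ ΣV-cons n k ⟩
    sum (λ c' → ΣV n (λ β → k (c' ∷ β)))  ≈⟨ sum-point _ c other-slice ⟩
    ΣV n (λ β → k (c ∷ β))                ≈⟨ ΣV-point n (λ β → k (c ∷ β)) α (λ β β≢α → off (c ∷ β) (β≢α ∘ P.cong tail)) ⟩
    k (c ∷ α)                             ∎
    where
    other-slice : ∀ c' → c' ≢ c → ΣV n (λ β → k (c' ∷ β)) ≈ 0#
    other-slice c' c'≢c =
      trans (ΣV-point n _ α (λ β β≢α → off (c' ∷ β) (c'≢c ∘ P.cong head))) (off (c' ∷ α) (c'≢c ∘ P.cong head))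

  -- The neighbours of c ∷ y are the c ∷ β with β ~ y and the c' ∷ y with c' ≠ c:
  --   Σ_{W₁(c ∷ y)} d + d(c ∷ y) = Σ_{W₁(y)} d(c ∷ ·) + Σ_{c'} d(c' ∷ y).
  neighbours-cons : ∀ n (d : V (suc n) → Carrier) c y →
    nbrSum d (c ∷ y) + d (c ∷ y) ≈ nbrSum (λ β → d (c ∷ β)) y + sum (λ c' → d (c' ∷ y))
  neighbours-cons n d c y = begin
    nbrSum d (c ∷ y) + d (c ∷ y)
      ≈⟨ +-congʳ (trans (nbrSum-onSphere d (c ∷ y)) (ΣV-cons n (onSphere (c ∷ y) d))) ⟩
    sum (λ c' → ΣV n (λ β → onSphere (c ∷ y) d (c' ∷ β))) + d (c ∷ y)
      ≈⟨ sum-replace _ (λ c' → d (c' ∷ y)) c same-slice other-slice ⟩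
    nbrSum (λ β → d (c ∷ β)) y + sum (λ c' → d (c' ∷ y)) ∎
    where
    same-slice : ΣV n (λ β → onSphere (c ∷ y) d (c ∷ β)) ≈ nbrSum (λ β → d (c ∷ β)) y
    same-slice = begin
      ΣV n (λ β → onSphere (c ∷ y) d (c ∷ β))
        ≡⟨ P.cong (∑ R) (map-cong (λ β → P.cong (λ r → if does (r ℕ.≟ 1) then d (c ∷ β) else 0#) (ρ-cons-≡ c y β)) (allVertices q n)) ⟩
      ΣV n (onSphere y (λ β → d (c ∷ β)))
        ≈⟨ sym (nbrSum-onSphere (λ β → d (c ∷ β)) y) ⟩
      nbrSum (λ β → d (c ∷ β)) y ∎
    -- on another slice only c' ∷ y is a neighbour of c ∷ y
    other-slice : ∀ c' → c' ≢ c → ΣV n (λ β → onSphere (c ∷ y) d (c' ∷ β)) ≈ d (c' ∷ y)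
    other-slice c' c'≢c = trans (ΣV-point n _ y off) (reflexive on)
      where
      c≢c' : c ≢ c'
      c≢c' = c'≢c ∘ P.sym
      off : ∀ β → β ≢ y → onSphere (c ∷ y) d (c' ∷ β) ≈ 0#
      off β β≢y rewrite ρ-cons-≢ y β c≢c' = not-adjacent (ρ y β) (β≢y ∘ P.sym ∘ ρ≡0⇒≡ y β)
        where
        not-adjacent : ∀ r → r ≢ 0 → (if does (suc r ℕ.≟ 1) then d (c' ∷ β) else 0#) ≈ 0#
        not-adjacent zero    r≢0 = ⊥-elim (r≢0 P.refl)
        not-adjacent (suc r) _   = refl
      on : onSphere (c ∷ y) d (c' ∷ y) ≡ d (c' ∷ y)
      on rewrite ρ-cons-≢ y y c≢c' | ρ-self y = P.refl

-- How the eigen-data (q·a, (q-1)·n + q·b) changes when passing to slices.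
data-shift : ∀ q' n b → suc (q' ℕ.* suc n ℕ.+ suc q' ℕ.* b) ≡ q' ℕ.* n ℕ.+ suc q' ℕ.* suc b
data-shift = solve-∀

data-split : ∀ q' n b → q' ℕ.* suc n ℕ.+ suc q' ℕ.* b ≡ q' ℕ.+ (q' ℕ.* n ℕ.+ suc q' ℕ.* b)
data-split = solve-∀

module Uniqueness {c ℓ} (R : CommutativeRing c ℓ) (domain : IsIntegralDomainChar0 R) (q' : ℕ) where
  open CommutativeRing R hiding (zero)
  open Arithmetic R
  open Distance
  open Neighbourhood R q'
  open import Relation.Binary.Reasoning.Setoid setoid

  ι-*-cancel : ∀ {A B} x → ι R A * x ≈ ι R B * x → A < B → x ≈ 0#
  ι-*-cancel {A} {B} x eq A<B with proj₁ (proj₂ domain) (ι R (B ∸ A)) x (sym excess≈0)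
    where
    excess≈0 : 0# ≈ ι R (B ∸ A) * x
    excess≈0 = +-cancelˡ (ι R A * x) 0# _ (begin
      ι R A * x + 0#                    ≈⟨ +-identityʳ _ ⟩
      ι R A * x                         ≈⟨ eq ⟩
      ι R B * x                         ≡⟨ P.cong (λ k → ι R k * x) (P.sym (ℕP.m+[n∸m]≡n (ℕP.<⇒≤ A<B))) ⟩
      ι R (A ℕ.+ (B ∸ A)) * x           ≈⟨ trans (*-congʳ (ι-+ A (B ∸ A))) (distribʳ x _ _) ⟩
      ι R A * x + ι R (B ∸ A) * x       ∎)
  ... | inj₂ x≈0 = x≈0
  ... | inj₁ ι≈0 = ⊥-elim (ℕP.<⇒≢ (ℕP.m<n⇒0<n∸m A<B) (P.sym (proj₂ (proj₂ domain) (B ∸ A) ι≈0)))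

  Eigen : ∀ n → ℕ → ℕ → (V n → Carrier) → Set ℓ
  Eigen n A B d = ∀ α → nbrSum d α + ι R A * d α ≈ ι R B * d α

  -- d vanishes on {α : ρ(α, z) + b ≤ a}, the ball of radius a - b around z
  Vanishes : ∀ {n} → V n → ℕ → ℕ → (V n → Carrier) → Set ℓ
  Vanishes z a b d = ∀ α → ρ α z ℕ.+ b ≤ a → d α ≈ 0#

  slice : ∀ {n} → (V (suc n) → Carrier) → Fin q → V n → Carrier
  slice d c y = d (c ∷ y)

  column : ∀ {n} → (V (suc n) → Carrier) → V n → Carrier
  column d y = sum (λ c → d (c ∷ y))

  slice-equation : ∀ {n A B} {d : V (suc n) → Carrier} → Eigen (suc n) A B d → ∀ c y →
    (nbrSum (slice d c) y + ι R A * slice d c y) + column d y ≈ ι R (suc B) * slice d c y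
  slice-equation {n} {A} {B} {d} eig c y = begin
    (nbrSum (slice d c) y + ι R A * x) + column d y ≈⟨ xy∙z≈xz∙y _ _ _ ⟩
    (nbrSum (slice d c) y + column d y) + ι R A * x ≈⟨ +-congʳ (sym (neighbours-cons n d c y)) ⟩
    (nbrSum d (c ∷ y) + x) + ι R A * x              ≈⟨ xy∙z≈xz∙y _ _ _ ⟩
    (nbrSum d (c ∷ y) + ι R A * x) + x              ≈⟨ +-congʳ (eig (c ∷ y)) ⟩
    ι R B * x + x                                   ≈⟨ +-comm _ x ⟩
    x + ι R B * x                                   ≈⟨ sym (ι-suc-* B x) ⟩
    ι R (suc B) * x                                 ∎
    where
    x = d (c ∷ y)

  -- the column sum cancels in the difference of two slices, which therefore
  -- has data (A, B + 1)
  sliceDiff-eigen : ∀ {n A B} {d : V (suc n) → Carrier} → Eigen (suc n) A B d → ∀ c c' →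
    Eigen n A (suc B) (λ y → slice d c y - slice d c' y)
  sliceDiff-eigen {n} {A} {B} {d} eig c c' y = begin
    nbrSum (λ β → g β - g' β) y + ι R A * (g y - g' y)
      ≈⟨ +-cong (nbrSum-sub g g' y) (*-distribˡ-sub _ _ _) ⟩
    (nbrSum g y - nbrSum g' y) + (ι R A * g y - ι R A * g' y)
      ≈⟨ sub-+-interchange _ _ _ _ ⟩
    (nbrSum g y + ι R A * g y) - (nbrSum g' y + ι R A * g' y)
      ≈⟨ sub-common (column d y) (slice-equation {A = A} {B} eig c y) (slice-equation {A = A} {B} eig c' y) ⟩
    ι R (suc B) * g y - ι R (suc B) * g' y
      ≈⟨ sym (*-distribˡ-sub _ _ _) ⟩
    ι R (suc B) * (g y - g' y) ∎
    where
    g  = slice d c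
    g' = slice d c'

  -- when all slices agree with the slice at c₀, the column sum is q times that
  -- slice, which therefore has data (A, B) if d has data (A, (q-1) + B)
  constantSlice-eigen : ∀ {n A B} {d : V (suc n) → Carrier} → Eigen (suc n) A (q' ℕ.+ B) d →
    ∀ c₀ → (∀ c y → slice d c y ≈ slice d c₀ y) → Eigen n A B (slice d c₀)
  constantSlice-eigen {n} {A} {B} {d} eig c₀ agree y = +-cancelʳ (ι R q * g y) _ _ (begin
    (nbrSum g y + ι R A * g y) + ι R q * g y ≈⟨ +-congˡ (sym column≈) ⟩
    (nbrSum g y + ι R A * g y) + column d y  ≈⟨ slice-equation {A = A} {q' ℕ.+ B} eig c₀ y ⟩
    ι R (q ℕ.+ B) * g y                      ≈⟨ *-congʳ (trans (ι-+ q B) (+-comm _ _)) ⟩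
    (ι R B + ι R q) * g y                    ≈⟨ distribʳ (g y) _ _ ⟩
    ι R B * g y + ι R q * g y                ∎)
    where
    g = slice d c₀
    column≈ : column d y ≈ ι R q * g y
    column≈ = trans (sum-cong-≋ (λ c → agree c y)) (sum-const q (g y))

  slice-vanishes : ∀ {n a b z₀} {z : V n} {d : V (suc n) → Carrier} →
    Vanishes (z₀ ∷ z) a b d → Vanishes z a b (slice d z₀)
  slice-vanishes {a = a} {b} {z₀} {z} van y within =
    van (z₀ ∷ y) (P.subst (λ r → r ℕ.+ b ≤ a) (P.sym (ρ-cons-≡ z₀ y z)) within)

  sliceDiff-vanishes : ∀ {n a b z₀} {z : V n} {d : V (suc n) → Carrier} →
    Vanishes (z₀ ∷ z) a b d → ∀ c → Vanishes z a (suc b) (λ y → slice d c y - slice d z₀ y)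
  sliceDiff-vanishes {a = a} {b} {z₀} {z} van c y within =
    x≈y⇒x∙y⁻¹≈ε (trans (van (c ∷ y) near) (sym (slice-vanishes van y centre)))
    where
    near : ρ (c ∷ y) (z₀ ∷ z) ℕ.+ b ≤ a
    near = ℕP.≤-trans (ℕP.+-monoˡ-≤ b (ρ-cons-≤ c z₀ y z)) (P.subst (_≤ a) (ℕP.+-suc (ρ y z) b) within)
    centre : ρ y z ℕ.+ b ≤ a
    centre = ℕP.≤-trans (ℕP.+-monoʳ-≤ (ρ y z) (ℕP.n≤1+n b)) within

  eigen-unique : ∀ n a b (z : V n) (d : V n → Carrier) →
    Eigen n (q ℕ.* a) (q' ℕ.* n ℕ.+ q ℕ.* b) d → Vanishes z a b d → ∀ α → d α ≈ 0#
  eigen-unique zero a b [] d eig van [] with b ℕP.≤? a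
  ... | yes b≤a = van [] b≤a
  ... | no  b≰a = ι-*-cancel (d []) (trans (sym (+-identityˡ _)) (eig [])) qa<qb
    where
    qa<qb : q ℕ.* a < q' ℕ.* 0 ℕ.+ q ℕ.* b
    qa<qb rewrite ℕP.*-zeroʳ q' = ℕP.*-monoʳ-< q (ℕP.≰⇒> b≰a)
  eigen-unique (suc n) a b (z₀ ∷ z) d eig van (c ∷ y) = begin
    d (c ∷ y)  ≈⟨ slices-agree c y ⟩
    d (z₀ ∷ y) ≈⟨ eigen-unique n a b z (slice d z₀) slice₀-eigen (slice-vanishes van) y ⟩
    0#         ∎
    where
    slices-agree : ∀ c y → slice d c y ≈ slice d z₀ y
    slices-agree c y = x∙y⁻¹≈ε⇒x≈y _ _
      (eigen-unique n a (suc b) z _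
        (P.subst (λ B → Eigen n (q ℕ.* a) B (λ y → slice d c y - slice d z₀ y)) (data-shift q' n b)
          (sliceDiff-eigen {A = q ℕ.* a} {q' ℕ.* suc n ℕ.+ q ℕ.* b} eig c z₀))
        (sliceDiff-vanishes van c) y)
    slice₀-eigen : Eigen n (q ℕ.* a) (q' ℕ.* n ℕ.+ q ℕ.* b) (slice d z₀)
    slice₀-eigen = constantSlice-eigen {A = q ℕ.* a}
      (P.subst (λ B → Eigen (suc n) (q ℕ.* a) B d) (data-split q' n b) eig) z₀ slices-agree

-- Two λ-functions with λ = (q-1)n - qh that agree on B_h agree everywhere:
-- their difference has eigen-data (q·h, (q-1)·n + q·0) and vanishes on B_h.
lemma5 : ∀ {c ℓ : Level} (R : CommutativeRing c ℓ) → IsIntegralDomainChar0 R →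
    (q n h : ℕ) → (q>2 : 2 < q) → 1 ≤ n → h ≤ n →
    let open CommutativeRing R
        lam = ι R ((q ∸ 1) ℕ.* n) - ι R (q ℕ.* h)
    in (f g : Vertex q n → Carrier) →
       IsλFunction R lam f → IsλFunction R lam g →
       (∀ α → α ∈B[ h , q>2 ] → f α ≈ g α) →
       ∀ α → f α ≈ g α
lemma5 R domain zero n h () _ _ f g fλ gλ agree α
lemma5 R domain (suc q') n h q>2 _ _ f g fλ gλ agree α =
  x∙y⁻¹≈ε⇒x≈y (f α) (g α) (eigen-unique n h 0 (𝟎 n q>2) d difference-eigen difference-vanishes α)
  where
  open CommutativeRing R hiding (zero)
  open Arithmetic R
  open Neighbourhood R q'
  open Uniqueness R domain q'
  open import Relation.Binary.Reasoning.Setoid setoid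

  lam : Carrier
  lam = ι R (q' ℕ.* n) - ι R (q ℕ.* h)

  d : V n → Carrier
  d β = f β - g β

  difference-eigen : Eigen n (q ℕ.* h) (q' ℕ.* n ℕ.+ q ℕ.* 0) d
  difference-eigen β = begin
    nbrSum d β + ι R (q ℕ.* h) * d β
      ≈⟨ +-congʳ (trans (nbrSum-sub f g β) (trans (+-cong (fλ β) (-‿cong (gλ β))) (sym (*-distribˡ-sub lam _ _)))) ⟩
    lam * d β + ι R (q ℕ.* h) * d β  ≈⟨ sym (distribʳ (d β) _ _) ⟩
    (lam + ι R (q ℕ.* h)) * d β      ≈⟨ *-congʳ (//-rightDividesˡ _ _) ⟩
    ι R (q' ℕ.* n) * d β             ≡⟨ P.cong (λ k → ι R k * d β) no-q-term ⟩
    ι R (q' ℕ.* n ℕ.+ q ℕ.* 0) * d β ∎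
    where
    no-q-term : q' ℕ.* n ≡ q' ℕ.* n ℕ.+ q ℕ.* 0
    no-q-term = P.sym (P.trans (P.cong (q' ℕ.* n ℕ.+_) (ℕP.*-zeroʳ q)) (ℕP.+-identityʳ _))

  difference-vanishes : Vanishes (𝟎 n q>2) h 0 d
  difference-vanishes β within = x≈y⇒x∙y⁻¹≈ε (agree β (P.subst (_≤ h) (ℕP.+-identityʳ _) within))
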